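{- Let $\alpha$ be a positive integer, $R$ a parameter and $h\ge 0$ an integer. Then \[ Q_h(\alpha,R;z)=\sum_{k=0}^{h}\binom{h}{k}(-1)^k\left(\prod_{j=0}^{k-1}\bigl(R+(h-1-j)\alpha\bigr)\right)z^k . \]
   Context: $Q_h(\alpha,R;z)$ is defined by $Q_h=(1-(R+2\alpha(h-1))z)Q_{h-1}-\alpha(R+\alpha(h-2))(h-1)z^2Q_{h-2}$ for $h\ge2$, $Q_1=1-Rz$, $Q_0=1$, $Q_h=0$ for $h<0$. An empty product equals $1$. -}

module Defs where

open import Level using (Level)
open import Data.Nat using (ℕ; zero; suc; _∸_)
open import Data.Nat.Combinatorics using (_C_)
open import Algebra.Bundles using (CommutativeRing)

module QDefs {c ℓ : Level} (𝓡 : CommutativeRing c ℓ) where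
  open CommutativeRing 𝓡

  ι : ℕ → Carrier
  ι zero    = 0#
  ι (suc n) = 1# + ι n

  pow : Carrier → ℕ → Carrier
  pow x zero    = 1#
  pow x (suc k) = x * pow x k

  sumTo : ℕ → (ℕ → Carrier) → Carrier
  sumTo zero    f = f 0
  sumTo (suc n) f = sumTo n f + f (suc n)

  prodBelow : ℕ → (ℕ → Carrier) → Carrier
  prodBelow zero    f = 1#
  prodBelow (suc k) f = prodBelow k f * f k

  Q : ℕ → ℕ → Carrier → Carrier → Carrier
  Q zero          α R z = 1#
  Q (suc zero)    α R z = 1# - R * z
  Q (suc (suc h)) α R z =
    (1# - (R + ι 2 * ι α * ι (suc h)) * z) * Q (suc h) α R z
    - ι α * (R + ι α * ι h) * ι (suc h) * (z * z) * Q h α R z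

  -- right-hand side: Σ_{k=0}^{h} C(h,k) (-1)^k Π_{j<k} (R + (h-1-j) α) z^k
  -- (h ∸ 1 ∸ j is exact subtraction since j ≤ k-1 ≤ h-1 in the range)
  RHS : ℕ → ℕ → Carrier → Carrier → Carrier
  RHS h α R z = sumTo h λ k →
    ι (h C k) * pow (- 1#) k * prodBelow k (λ j → R + ι (h ∸ 1 ∸ j) * ι α) * pow z k

-- Both sides satisfy the same three-term recurrence.  After the substitution w = -z the
-- right-hand side becomes  Σ_k C(h,k) Π_{j<k} (R + (h-1-j)α) w^k,  a polynomial with
-- sign-free coefficients, and the recurrence becomes a coefficientwise identity.
-- Peeling the factors R + (h+1)α and R + hα off the products reduces it to two facts
-- about binomial coefficients: Pascal's rule (the coefficient of R) and an identity
-- combining Pascal's rule with absorption (the coefficient of α).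
module Submission where

open import Defs
open import Level using (Level)
open import Data.Nat using (ℕ; _≤_)
open import Algebra.Bundles using (CommutativeRing)

open import Data.Nat as Nat using (zero; suc; _∸_; _<_; s≤s; z≤n)
open import Data.Nat.Properties as Natₚ using (n<1+n; ∸-+-assoc; m+n∸n≡m)
open import Data.Nat.Combinatorics using (_C_; nC1≡n; nCk+nC[k+1]≡[n+1]C[k+1]; k>n⇒nCk≡0)
open import Relation.Binary.PropositionalEquality as ≡ using (_≡_)

module _ where
  open ≡.≡-Reasoning
  open import Data.Nat.Tactic.RingSolver using (solve; solve-∀)
  open import Data.List using (_∷_; [])
  open Nat using (_+_; _*_)

  pascal : ∀ n k → n C k + n C suc k ≡ suc n C suc k
  pascal = nCk+nC[k+1]≡[n+1]C[k+1]

  absorption : ∀ n k → suc k * (suc n C suc k) ≡ suc n * (n C k)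
  absorption zero zero = ≡.refl
  absorption zero (suc k)
    rewrite k>n⇒nCk≡0 {1} {2 + k} (s≤s (s≤s z≤n)) | k>n⇒nCk≡0 {0} {suc k} (s≤s z≤n) = Natₚ.*-zeroʳ (2 + k)
  absorption (suc n) zero rewrite nC1≡n (2 + n) = solve (n ∷ [])
  absorption (suc n) (suc k) = begin
    (2 + k) * (suc (suc n) C (2 + k))               ≡⟨ ≡.cong ((2 + k) *_) (pascal (suc n) (suc k)) ⟨
    (2 + k) * (A + B)                                ≡⟨ Natₚ.*-distribˡ-+ (2 + k) A B ⟩
    A + (1 + k) * A + (2 + k) * B                    ≡⟨ ≡.cong₂ (λ a b → A + a + b) (absorption n k) (absorption n (suc k)) ⟩
    A + (1 + n) * (n C k) + (1 + n) * (n C suc k)    ≡⟨ Natₚ.+-assoc A ((1 + n) * (n C k)) _ ⟩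
    A + ((1 + n) * (n C k) + (1 + n) * (n C suc k))  ≡⟨ ≡.cong (A +_) (Natₚ.*-distribˡ-+ (1 + n) (n C k) (n C suc k)) ⟨
    A + (1 + n) * (n C k + n C suc k)                ≡⟨ ≡.cong (λ c → A + (1 + n) * c) (pascal n k) ⟩
    (2 + n) * A                                      ∎
    where
    A = suc n C suc k
    B = suc n C (2 + k)

  absorption-complement : ∀ n k → (suc n ∸ k) * (suc n C k) ≡ suc n * (n C k)
  absorption-complement n k = begin
    (suc n ∸ k) * (suc n C k)                        ≡⟨ Natₚ.*-distribʳ-∸ (suc n C k) (suc n) k ⟩
    suc n * (suc n C k) ∸ k * (suc n C k)            ≡⟨ ≡.cong (_∸ k * (suc n C k)) (split k) ⟩
    suc n * (n C k) + k * (suc n C k) ∸ k * (suc n C k) ≡⟨ m+n∸n≡m (suc n * (n C k)) (k * (suc n C k)) ⟩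
    suc n * (n C k)                                  ∎
    where
    split : ∀ k → suc n * (suc n C k) ≡ suc n * (n C k) + k * (suc n C k)
    split zero = ≡.sym (Natₚ.+-identityʳ _)
    split (suc j) = begin
      suc n * (suc n C suc j)                        ≡⟨ ≡.cong (suc n *_) (pascal n j) ⟨
      suc n * (n C j + n C suc j)                    ≡⟨ Natₚ.*-distribˡ-+ (suc n) (n C j) (n C suc j) ⟩
      suc n * (n C j) + suc n * (n C suc j)          ≡⟨ ≡.cong (_+ suc n * (n C suc j)) (absorption n j) ⟨
      suc j * (suc n C suc j) + suc n * (n C suc j)  ≡⟨ Natₚ.+-comm (suc j * (suc n C suc j)) _ ⟩
      suc n * (n C suc j) + suc j * (suc n C suc j)  ∎

  weighted-pascal : ∀ n m →
    (suc (suc n) C (2 + m)) * suc n + suc n * (n C m)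
      ≡ (suc n C (2 + m)) * (n ∸ 1 ∸ m) + 2 * (suc n * (suc n C suc m))
  weighted-pascal n m = begin
    (suc (suc n) C (2 + m)) * suc n + suc n * X
      ≡⟨ ≡.cong (λ a → a * suc n + suc n * X) (pascal (suc n) (suc m)) ⟨
    (suc n C suc m + suc n C (2 + m)) * suc n + suc n * X
      ≡⟨ ≡.cong₂ (λ a b → (a + b) * suc n + suc n * X) (pascal n m) (pascal n (suc m)) ⟨
    (X + Y + (Y + Z)) * suc n + suc n * X            ≡⟨ rearrange X Y Z n ⟩
    suc n * Z + 2 * (suc n * (X + Y))
      ≡⟨ ≡.cong₂ (λ a b → a + 2 * (suc n * b)) (≡.sym (absorption-complement n (2 + m))) (pascal n m) ⟩
    (n ∸ suc m) * (suc n C (2 + m)) + 2 * (suc n * (suc n C suc m))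
      ≡⟨ ≡.cong (_+ 2 * (suc n * (suc n C suc m))) (Natₚ.*-comm (n ∸ suc m) (suc n C (2 + m))) ⟩
    (suc n C (2 + m)) * (n ∸ suc m) + 2 * (suc n * (suc n C suc m))
      ≡⟨ ≡.cong (λ a → (suc n C (2 + m)) * a + 2 * (suc n * (suc n C suc m))) (∸-+-assoc n 1 m) ⟨
    (suc n C (2 + m)) * (n ∸ 1 ∸ m) + 2 * (suc n * (suc n C suc m)) ∎
    where
    X = n C m
    Y = n C suc m
    Z = n C (2 + m)
    rearrange : ∀ x y z n → (x + y + (y + z)) * suc n + suc n * x ≡ suc n * z + 2 * (suc n * (x + y))
    rearrange = solve-∀

module _ {c ℓ : Level} (𝓡 : CommutativeRing c ℓ) where
  open CommutativeRing 𝓡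
  open QDefs 𝓡
  open import Algebra.Properties.Ring ring using (-‿distribˡ-*; -‿distribʳ-*; -‿involutive; -1*x≈-x; [y-z]x≈yx-zx)
  open import Algebra.Properties.Group +-group using (//-rightDividesʳ)
  open import Algebra.Properties.CommutativeSemigroup +-commutativeSemigroup using (interchange)
  open import Algebra.Properties.CommutativeSemigroup *-commutativeSemigroup using () renaming (interchange to *-interchange)
  open import Algebra.Properties.Semiring.Mult semiring using (_×_; ×-homo-+; ×1-homo-*)
  open import Algebra.Solver.Ring.NaturalCoefficients.Default commutativeSemiring
    using (solve; _:=_; _:+_; _:*_; con)
  open import Relation.Binary.Reasoning.Setoid setoid

  ι≡×1# : ∀ n → ι n ≡ n × 1#
  ι≡×1# zero = ≡.refl
  ι≡×1# (suc n) = ≡.cong (1# +_) (ι≡×1# n)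

  ι-+ : ∀ m n → ι (m Nat.+ n) ≈ ι m + ι n
  ι-+ m n rewrite ι≡×1# (m Nat.+ n) | ι≡×1# m | ι≡×1# n = ×-homo-+ 1# m n

  ι-* : ∀ m n → ι (m Nat.* n) ≈ ι m * ι n
  ι-* m n rewrite ι≡×1# (m Nat.* n) | ι≡×1# m | ι≡×1# n = ×1-homo-* m n

  sumTo-cong : ∀ N {f g} → (∀ k → f k ≈ g k) → sumTo N f ≈ sumTo N g
  sumTo-cong zero    f≈g = f≈g 0
  sumTo-cong (suc N) f≈g = +-cong (sumTo-cong N f≈g) (f≈g (suc N))

  sumTo-+ : ∀ N f g → sumTo N (λ k → f k + g k) ≈ sumTo N f + sumTo N g
  sumTo-+ zero    f g = refl
  sumTo-+ (suc N) f g = trans (+-congʳ (sumTo-+ N f g)) (interchange _ _ _ _)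

  sumTo-*ˡ : ∀ N a f → sumTo N (λ k → a * f k) ≈ a * sumTo N f
  sumTo-*ˡ zero    a f = refl
  sumTo-*ˡ (suc N) a f = trans (+-congʳ (sumTo-*ˡ N a f)) (sym (distribˡ a _ _))

  sumTo-suc : ∀ N f → sumTo (suc N) f ≈ f 0 + sumTo N (λ k → f (suc k))
  sumTo-suc zero    f = refl
  sumTo-suc (suc N) f = trans (+-congʳ (sumTo-suc N f)) (+-assoc _ _ _)

  prodBelow-cong : ∀ k {f g} → (∀ j → f j ≈ g j) → prodBelow k f ≈ prodBelow k g
  prodBelow-cong zero    f≈g = refl
  prodBelow-cong (suc k) f≈g = *-cong (prodBelow-cong k f≈g) (f≈g k)

  prodBelow-suc : ∀ k f → prodBelow (suc k) f ≈ f 0 * prodBelow k (λ j → f (suc j))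
  prodBelow-suc zero    f = trans (*-identityˡ _) (sym (*-identityʳ _))
  prodBelow-suc (suc k) f = trans (*-congʳ (prodBelow-suc k f)) (*-assoc _ _ _)

  eval : ℕ → (ℕ → Carrier) → Carrier → Carrier
  eval N f w = sumTo N (λ k → f k * pow w k)

  shift : (ℕ → Carrier) → ℕ → Carrier
  shift f zero    = 0#
  shift f (suc k) = f k

  eval-cong : ∀ N {f g} w → (∀ k → f k ≈ g k) → eval N f w ≈ eval N g w
  eval-cong N w f≈g = sumTo-cong N (λ k → *-congʳ (f≈g k))

  eval-+ : ∀ N f g w → eval N (λ k → f k + g k) w ≈ eval N f w + eval N g w
  eval-+ N f g w = trans (sumTo-cong N (λ k → distribʳ (pow w k) (f k) (g k))) (sumTo-+ N _ _)

  eval-*ˡ : ∀ N a f w → eval N (λ k → a * f k) w ≈ a * eval N f w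
  eval-*ˡ N a f w = trans (sumTo-cong N (λ k → *-assoc a (f k) (pow w k))) (sumTo-*ˡ N a _)

  eval-shift : ∀ N f w → eval (suc N) (shift f) w ≈ w * eval N f w
  eval-shift N f w = begin
    eval (suc N) (shift f) w                          ≈⟨ sumTo-suc N _ ⟩
    0# * 1# + sumTo N (λ k → f k * (w * pow w k))     ≈⟨ +-cong (zeroˡ 1#) (sumTo-cong N (λ k → x[yz]≈y[xz] (f k) w (pow w k))) ⟩
    0# + sumTo N (λ k → w * (f k * pow w k))          ≈⟨ +-identityˡ _ ⟩
    sumTo N (λ k → w * (f k * pow w k))               ≈⟨ sumTo-*ˡ N w _ ⟩
    w * eval N f w                                    ∎
    where
    x[yz]≈y[xz] : ∀ x y z → x * (y * z) ≈ y * (x * z)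
    x[yz]≈y[xz] = solve 3 (λ x y z → x :* (y :* z) := y :* (x :* z)) refl

  eval-dropLast : ∀ N f w → f (suc N) ≈ 0# → eval (suc N) f w ≈ eval N f w
  eval-dropLast N f w f[1+N]≈0 = trans (+-congˡ (trans (*-congʳ f[1+N]≈0) (zeroˡ _))) (+-identityʳ _)

  module Coefficients (α : ℕ) (R : Carrier) where

    factor : ℕ → ℕ → Carrier
    factor h j = R + ι (h ∸ 1 ∸ j) * ι α

    coeff : ℕ → ℕ → Carrier
    coeff h k = ι (h C k) * prodBelow k (factor h)

    linear quadratic : ℕ → Carrier
    linear    h = R + ι 2 * ι α * ι (suc h)
    quadratic h = ι α * (R + ι α * ι h) * ι (suc h)

    prodBelow-factor-suc : ∀ h k → prodBelow (suc k) (factor (suc h)) ≈ (R + ι h * ι α) * prodBelow k (factor h)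
    prodBelow-factor-suc h k = trans (prodBelow-suc k (factor (suc h)))
      (*-congˡ (prodBelow-cong k (λ j → +-congˡ (*-congʳ (reflexive (≡.cong ι (≡.sym (∸-+-assoc h 1 j))))))))

    coeff-vanish : ∀ {h k} → h < k → coeff h k ≈ 0#
    coeff-vanish h<k rewrite k>n⇒nCk≡0 h<k = zeroˡ _

    coeff-recurrence : ∀ n k →
      coeff (2 Nat.+ n) k + quadratic n * shift (shift (coeff n)) k
        ≈ coeff (suc n) k + linear n * shift (coeff (suc n)) k
    coeff-recurrence n zero = +-congˡ (trans (zeroʳ _) (sym (zeroʳ _)))
    coeff-recurrence n (suc zero) rewrite nC1≡n (2 Nat.+ n) | nC1≡n (suc n) =
      solve 4 (λ N A R q →
          (o :+ (o :+ N)) :* (o :* (R :+ (o :+ N) :* A)) :+ q :* con 0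
        := (o :+ N) :* (o :* (R :+ N :* A)) :+ (R :+ (o :+ (o :+ con 0)) :* A :* (o :+ N)) :* ((o :+ con 0) :* o))
        refl (ι n) (ι α) R (quadratic n)
      where o = con 1
    coeff-recurrence n (suc (suc m)) = begin
      coeff (2 Nat.+ n) (2 Nat.+ m) + quadratic n * coeff n m
        ≈⟨ +-congʳ (*-congˡ (trans (prodBelow-factor-suc (suc n) (suc m)) (*-congˡ (prodBelow-factor-suc n m)))) ⟩
      ι a * (x₁ * (x₀ * P)) + quadratic n * (ι f * P)
        ≈⟨ collectˡ (ι a) (ι f) R (ι n) (ι α) P ⟩
      x₀ * P * (ι a * R + ι α * (ι a * ι (suc n) + ι (suc n) * ι f))
        ≈⟨ *-congˡ (+-cong (*-congʳ R-part) (*-congˡ α-part)) ⟩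
      x₀ * P * ((ι e + ι b) * R + ι α * (ι b * ι w + ι 2 * (ι (suc n) * ι e)))
        ≈⟨ collectʳ (ι b) (ι e) (ι w) R (ι n) (ι α) P ⟨
      ι b * (x₀ * (P * factor n m)) + linear n * (ι e * (x₀ * P))
        ≈⟨ +-cong (*-congˡ (prodBelow-factor-suc n (suc m))) (*-congˡ (*-congˡ (prodBelow-factor-suc n m))) ⟨
      coeff (suc n) (2 Nat.+ m) + linear n * coeff (suc n) (suc m) ∎
      where
      a b e f w : ℕ
      a = suc (suc n) C (2 Nat.+ m)
      b = suc n C (2 Nat.+ m)
      e = suc n C suc m
      f = n C m
      w = n ∸ 1 ∸ m
      x₀ x₁ P : Carrier
      x₀ = R + ι n * ι α
      x₁ = R + ι (suc n) * ι α
      P  = prodBelow m (factor n)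
      R-part : ι a ≈ ι e + ι b
      R-part = trans (reflexive (≡.cong ι (≡.sym (pascal (suc n) (suc m))))) (ι-+ e b)
      α-part : ι a * ι (suc n) + ι (suc n) * ι f ≈ ι b * ι w + ι 2 * (ι (suc n) * ι e)
      α-part = begin
        ι a * ι (suc n) + ι (suc n) * ι f                 ≈⟨ +-cong (ι-* a (suc n)) (ι-* (suc n) f) ⟨
        ι (a Nat.* suc n) + ι (suc n Nat.* f)             ≈⟨ ι-+ (a Nat.* suc n) (suc n Nat.* f) ⟨
        ι (a Nat.* suc n Nat.+ suc n Nat.* f)             ≡⟨ ≡.cong ι (weighted-pascal n m) ⟩
        ι (b Nat.* w Nat.+ 2 Nat.* (suc n Nat.* e))       ≈⟨ ι-+ (b Nat.* w) (2 Nat.* (suc n Nat.* e)) ⟩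
        ι (b Nat.* w) + ι (2 Nat.* (suc n Nat.* e))       ≈⟨ +-cong (ι-* b w) (trans (ι-* 2 (suc n Nat.* e)) (*-congˡ (ι-* (suc n) e))) ⟩
        ι b * ι w + ι 2 * (ι (suc n) * ι e)               ∎
      collectˡ : ∀ a f R N A P →
        a * ((R + (1# + N) * A) * ((R + N * A) * P)) + A * (R + A * N) * (1# + N) * (f * P)
          ≈ (R + N * A) * P * (a * R + A * (a * (1# + N) + (1# + N) * f))
      collectˡ = solve 6 (λ a f R N A P →
          a :* ((R :+ (con 1 :+ N) :* A) :* ((R :+ N :* A) :* P)) :+ A :* (R :+ A :* N) :* (con 1 :+ N) :* (f :* P)
        := (R :+ N :* A) :* P :* (a :* R :+ A :* (a :* (con 1 :+ N) :+ (con 1 :+ N) :* f))) refl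
      collectʳ : ∀ b e w R N A P →
        b * ((R + N * A) * (P * (R + w * A))) + (R + (1# + (1# + 0#)) * A * (1# + N)) * (e * ((R + N * A) * P))
          ≈ (R + N * A) * P * ((e + b) * R + A * (b * w + (1# + (1# + 0#)) * ((1# + N) * e)))
      collectʳ = solve 7 (λ b e w R N A P →
          b :* ((R :+ N :* A) :* (P :* (R :+ w :* A))) :+ (R :+ (con 1 :+ (con 1 :+ con 0)) :* A :* (con 1 :+ N)) :* (e :* ((R :+ N :* A) :* P))
        := (R :+ N :* A) :* P :* ((e :+ b) :* R :+ A :* (b :* w :+ (con 1 :+ (con 1 :+ con 0)) :* ((con 1 :+ N) :* e)))) refl

    series : ℕ → Carrier → Carrier
    series h w = eval h (coeff h) w

    series-recurrence : ∀ n w →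
      series (2 Nat.+ n) w + quadratic n * (w * (w * series n w))
        ≈ series (suc n) w + linear n * (w * series (suc n) w)
    series-recurrence n w = begin
      series (2 Nat.+ n) w + quadratic n * (w * (w * series n w))
        ≈⟨ +-congˡ (*-congˡ (trans (eval-shift (suc n) (shift (coeff n)) w) (*-congˡ (eval-shift n (coeff n) w)))) ⟨
      series (2 Nat.+ n) w + quadratic n * eval (2 Nat.+ n) (shift (shift (coeff n))) w
        ≈⟨ +-congˡ (eval-*ˡ (2 Nat.+ n) (quadratic n) _ w) ⟨
      eval (2 Nat.+ n) (coeff (2 Nat.+ n)) w + eval (2 Nat.+ n) (λ k → quadratic n * shift (shift (coeff n)) k) w
        ≈⟨ eval-+ (2 Nat.+ n) _ _ w ⟨
      eval (2 Nat.+ n) (λ k → coeff (2 Nat.+ n) k + quadratic n * shift (shift (coeff n)) k) w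
        ≈⟨ eval-cong (2 Nat.+ n) w (coeff-recurrence n) ⟩
      eval (2 Nat.+ n) (λ k → coeff (suc n) k + linear n * shift (coeff (suc n)) k) w
        ≈⟨ eval-+ (2 Nat.+ n) _ _ w ⟩
      eval (2 Nat.+ n) (coeff (suc n)) w + eval (2 Nat.+ n) (λ k → linear n * shift (coeff (suc n)) k) w
        ≈⟨ +-cong (eval-dropLast (suc n) (coeff (suc n)) w (coeff-vanish (n<1+n (suc n))))
                  (trans (eval-*ˡ (2 Nat.+ n) (linear n) _ w) (*-congˡ (eval-shift (suc n) (coeff (suc n)) w))) ⟩
      series (suc n) w + linear n * (w * series (suc n) w) ∎

  recurrence-at-neg : ∀ l q z {Q₁ Q₀ S₂ S₁ S₀} → Q₁ ≈ S₁ → Q₀ ≈ S₀ →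
    S₂ + q * (- z * (- z * S₀)) ≈ S₁ + l * (- z * S₁) →
    (1# - l * z) * Q₁ - q * (z * z) * Q₀ ≈ S₂
  recurrence-at-neg l q z {Q₁} {Q₀} {S₂} {S₁} {S₀} Q₁≈S₁ Q₀≈S₀ S-rec = begin
    (1# - l * z) * Q₁ - q * (z * z) * Q₀  ≈⟨ +-cong (*-congˡ Q₁≈S₁) (-‿cong (*-congˡ Q₀≈S₀)) ⟩
    (1# - l * z) * S₁ - q * (z * z) * S₀  ≈⟨ +-cong linear-term (-‿cong quadratic-term) ⟩
    S₁ + l * (- z * S₁) - q * (- z * (- z * S₀)) ≈⟨ +-congʳ S-rec ⟨
    S₂ + q * (- z * (- z * S₀)) - q * (- z * (- z * S₀)) ≈⟨ //-rightDividesʳ _ S₂ ⟩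
    S₂                                     ∎
    where
    linear-term : (1# - l * z) * S₁ ≈ S₁ + l * (- z * S₁)
    linear-term = begin
      (1# - l * z) * S₁         ≈⟨ [y-z]x≈yx-zx S₁ 1# (l * z) ⟩
      1# * S₁ - l * z * S₁      ≈⟨ +-cong (*-identityˡ S₁) (-‿cong (*-assoc l z S₁)) ⟩
      S₁ - l * (z * S₁)         ≈⟨ +-congˡ (-‿distribʳ-* l (z * S₁)) ⟩
      S₁ + l * - (z * S₁)       ≈⟨ +-congˡ (*-congˡ (-‿distribˡ-* z S₁)) ⟩
      S₁ + l * (- z * S₁)       ∎
    quadratic-term : q * (z * z) * S₀ ≈ q * (- z * (- z * S₀))
    quadratic-term = begin
      q * (z * z) * S₀          ≈⟨ trans (*-assoc q _ S₀) (*-congˡ (*-assoc z z S₀)) ⟩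
      q * (z * (z * S₀))        ≈⟨ *-congˡ (-‿involutive _) ⟨
      q * - - (z * (z * S₀))    ≈⟨ *-congˡ (-‿cong (-‿distribˡ-* z (z * S₀))) ⟩
      q * - (- z * (z * S₀))    ≈⟨ *-congˡ (-‿distribʳ-* (- z) (z * S₀)) ⟩
      q * (- z * - (z * S₀))    ≈⟨ *-congˡ (*-congˡ (-‿distribˡ-* z S₀)) ⟩
      q * (- z * (- z * S₀))    ∎

  Q≈series : ∀ α R z h → Q h α R z ≈ Coefficients.series α R h (- z)
  Q≈series α R z zero = solve 0 (con 1 := (con 1 :+ con 0) :* con 1 :* con 1) refl
  Q≈series α R z (suc zero) = begin
    1# - R * z        ≈⟨ +-congˡ (-‿distribʳ-* R z) ⟩
    1# + R * - z      ≈⟨ expand R (- z) (ι α) ⟩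
    Coefficients.series α R 1 (- z) ∎
    where
    expand : ∀ R w A → 1# + R * w ≈ (1# + 0#) * 1# * 1# + (1# + 0#) * (1# * (R + 0# * A)) * (w * 1#)
    expand = solve 3 (λ R w A → con 1 :+ R :* w
      := (con 1 :+ con 0) :* con 1 :* con 1 :+ (con 1 :+ con 0) :* (con 1 :* (R :+ con 0 :* A)) :* (w :* con 1)) refl
  Q≈series α R z (suc (suc n)) =
    recurrence-at-neg (linear n) (quadratic n) z (Q≈series α R z (suc n)) (Q≈series α R z n) (series-recurrence n (- z))
    where open Coefficients α R

  pow-neg : ∀ x k → pow (- 1#) k * pow x k ≈ pow (- x) k
  pow-neg x zero    = *-identityˡ 1#
  pow-neg x (suc k) = trans (*-interchange (- 1#) _ x _) (*-cong (-1*x≈-x x) (pow-neg x k))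

  RHS≈series : ∀ α R z h → RHS h α R z ≈ Coefficients.series α R h (- z)
  RHS≈series α R z h = sumTo-cong h λ k → trans (reassoc _ _ _ _) (*-congˡ (pow-neg z k))
    where
    reassoc : ∀ c s p Z → c * s * p * Z ≈ c * p * (s * Z)
    reassoc = solve 4 (λ c s p Z → c :* s :* p :* Z := c :* p :* (s :* Z)) refl

mainTheorem4 : ∀ {c ℓ : Level} (𝓡 : CommutativeRing c ℓ) (α : ℕ) → 1 ≤ α →
                 (R z : CommutativeRing.Carrier 𝓡) (h : ℕ) →
                 CommutativeRing._≈_ 𝓡 (QDefs.Q 𝓡 h α R z) (QDefs.RHS 𝓡 h α R z)
mainTheorem4 𝓡 α _ R z h =
  CommutativeRing.trans 𝓡 (Q≈series 𝓡 α R z h) (CommutativeRing.sym 𝓡 (RHS≈series 𝓡 α R z h))
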